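{- Let $d \ge 2$, and let $b_1, \dots, b_d\ge 2$ be pairwise relatively prime integers. Let $r$ be Euler's totient function of $b_1$. Let $\ell, k, c_2, \dots, c_d\in\mathbb{N}$ (positive integers), and define \[ n=(b_1^{k}-1) b_1^{\ell+1},\quad m=n + (b_1+1) b_1^\ell \prod_{j=2}^d b_j^{rc_jb_1^k}.\] Then \[ |\varphi_{b_j}(n)-\varphi_{b_j}(m)|\leq \frac{1}{b_j^{rc_jb_1^k}} \] for all $2 \le j \le d$, and \[ |\varphi_{b_1}(n)-\varphi_{b_1}(m)|\leq \frac{2}{b_1^{\ell+k+1}}. \]
   Context: For an integer $b\ge 2$ and $n=n_0+n_1b+n_2b^2+\cdots\in\mathbb{N}_0$ (base-$b$ digits $n_i\in\{0,\ldots,b-1\}$), the radical inverse is $\varphi_b(n)=\sum_{i\ge 0} n_i b^{ -i-1}\in[0,1)$. -}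

module Defs where

open import Data.Nat using (ℕ; zero; suc; _+_; _*_; _^_)
open import Data.Nat.DivMod using (_/_; _%_)
open import Data.Nat.Coprimality using (coprime?)
open import Data.Nat.ListAction using (product)
open import Data.List using (List; length; filter; map; upTo; allFin)
open import Data.Fin using (Fin)
open import Data.Integer using (+_)
import Data.Rational as ℚ
open ℚ using (ℚ; 0ℚ)

totient : ℕ → ℕ
totient n = length (filter (λ i → coprime? i n) (map suc (upTo n)))

prodFin : (e : ℕ) → (Fin e → ℕ) → ℕ
prodFin e f = product (map f (allFin e))

ℕ→ℚ : ℕ → ℚ
ℕ→ℚ n = (+ n) ℚ./ 1

-- reciprocal 1/q of a natural number q (convention 1/0 = 0; only used with q ≥ 1)
recip : ℕ → ℚ
recip zero = 0ℚ
recip (suc q) = (+ 1) ℚ./ (suc q)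

-- Radical inverse φ_b(n) = Σ_{i ≥ 0} n_i b^{-i-1}, computed by the digit recursion
-- φ_b(n) = (n mod b + φ_b(n div b)) / b, with φ_b(0) = 0.
-- Recursion carries fuel; fuel n+1 suffices since the number of base-b digits of n is ≤ n
-- for b ≥ 2 (extra fuel only adds zero digits). Defined for b ≥ 2; bases 0,1 give 0 (unused).
radInvAux : ℕ → ℕ → ℕ → ℚ
radInvAux b zero n = 0ℚ
radInvAux b (suc f) n = (ℕ→ℚ (n % b′) ℚ.+ radInvAux b f (n / b′)) ℚ.* recip b′
  where b′ = suc (suc b)

radInv : ℕ → ℕ → ℚ
radInv zero n = 0ℚ
radInv (suc zero) n = 0ℚ
radInv (suc (suc b)) n = radInvAux b (suc n) n

{-# OPTIONS --safe #-}
-- Radical inverses of two numbers that agree modulo b^N share their first N digits, hence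
-- differ by at most b^-N; for j ≥ 2 this applies because b_j^(r c_j b_1^k) divides m - n.
-- For b = b_1, Euler's theorem and the lifting x ≡ 1 (mod b^i) ⇒ x^b ≡ 1 (mod b^(i+1)) give
-- P = ∏_j b_j^(r c_j b^k) = 1 + b^(k+1) t, so m = b^ℓ (1 + b^(k+1) s) with s = 1 + (b+1) t,
-- while n = b^(ℓ+1) (b^k - 1). Reading off digits, φ_b(n) = b^-(ℓ+1) (1 - b^-k) and
-- φ_b(m) = b^-(ℓ+1) (1 + b^-k φ_b(s)), whose difference b^-(ℓ+k+1) (1 + φ_b(s)) is at most
-- 2 b^-(ℓ+k+1).

module Submission where

open import Defs
open import Data.Nat using (ℕ; suc; _+_; _*_; _^_; _∸_; _≤_)
open import Data.Nat.Coprimality using (Coprime)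
open import Data.Fin using (Fin)
open import Data.Product using (_×_)
open import Relation.Binary.PropositionalEquality using (_≢_)
open import Data.Rational using (∣_∣; _-_) renaming (_≤_ to _≤ℚ_; _*_ to _*ℚ_)

open import Function using (_∘_)
open import Data.Nat using (zero; _<_; NonZero; z≤n; s≤s; s≤s⁻¹; z<s)
open import Data.Nat.Properties
open import Data.Nat.DivMod
open import Data.Nat.Divisibility
  using (_∣_; divides; quotient; ∣-trans; n∣m*n; ∣n⇒∣m*n; _∣0; ∣n∣m%n⇒∣m; %-presˡ-∣; m∣n⇒n≡m*quotient)
import Data.Nat.Coprimality as Coprime
open import Data.Nat.GCD using (module Bézout)
open import Data.Nat.ListAction using (product)
open import Data.Nat.ListAction.Properties using (∈⇒∣product)
open import Data.Nat.Tactic.RingSolver using (solve-∀)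
open import Data.Fin as Fin using (toℕ; fromℕ<)
import Data.Fin.Properties as Fin
open import Data.Fin.Permutation using (Permutation; permutation)
open import Data.List using (List; []; _∷_; [_]; _++_; _∷ʳ_; length; filter; map; upTo; applyUpTo; tabulate; allFin)
open import Data.List.Properties using (length-++; filter-++; filter-accept; filter-reject; upTo-∷ʳ; map-upTo)
open import Data.List.Relation.Unary.All using (All; []; _∷_; universal)
open import Data.List.Relation.Unary.All.Properties using (map⁺)
open import Data.List.Membership.Propositional.Properties using (∈-map⁺; ∈-allFin)
open import Data.Product using (∃-syntax; _,_)
import Data.Integer as ℤ
import Data.Integer.Properties as ℤ
open import Data.Rational using (0ℚ; 1ℚ; mkℚ; -_; *≤*; nonNegative) renaming (_+_ to _+ℚ_)
open import Data.Sum using (inj₁; inj₂)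
import Data.Rational.Properties as ℚ
open import Data.Rational.Solver using (module +-*-Solver)
open import Relation.Binary.PropositionalEquality
  using (_≡_; refl; sym; trans; cong; cong₂; subst; subst₂; module ≡-Reasoning)
open import Relation.Nullary using (Dec; yes; no)
open import Data.Empty using (⊥-elim)
open import Algebra.Properties.CommutativeMonoid.Sum *-1-commutativeMonoid
  using () renaming (sum to ∏; sum-permute to ∏-permute)
open import Algebra.Properties.CommutativeMonoid.Sum +-0-commutativeMonoid using (sum; sum-syntax)

-- Congruence to 1

-- Stronger than a % K ≡ 1 % K: it also forces a ≥ 1.
record _≡1[mod_] (a K : ℕ) : Set where
  constructor _,_
  field
    quotient : ℕ
    equation : a ≡ 1 + K * quotient

infix 4 _≡1[mod_]

1≡1[mod] : ∀ K → 1 ≡1[mod K ]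
1≡1[mod] K = 0 , cong suc (sym (*-zeroʳ K))

≡1[mod]-* : ∀ {K a b} → a ≡1[mod K ] → b ≡1[mod K ] → a * b ≡1[mod K ]
≡1[mod]-* {K} (s , refl) (t , refl) = s + t + K * s * t , expand K s t
  where
  expand : ∀ K s t → (1 + K * s) * (1 + K * t) ≡ 1 + K * (s + t + K * s * t)
  expand = solve-∀

≡1[mod]-^ : ∀ {K a} → a ≡1[mod K ] → ∀ c → a ^ c ≡1[mod K ]
≡1[mod]-^ {K} _    zero    = 1≡1[mod] K
≡1[mod]-^ a≡1 (suc c) = ≡1[mod]-* a≡1 (≡1[mod]-^ a≡1 c)

≡1[mod]-product : ∀ {K xs} → All (_≡1[mod K ]) xs → product xs ≡1[mod K ]
≡1[mod]-product {K} []             = 1≡1[mod] K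
≡1[mod]-product (x≡1 ∷ xs≡1) = ≡1[mod]-* x≡1 (≡1[mod]-product xs≡1)

[1+y]^n≡1+y[n+yh] : ∀ y n → ∃[ h ] (1 + y) ^ n ≡ 1 + y * (n + y * h)
[1+y]^n≡1+y[n+yh] y zero    = 0 , base y
  where
  base : ∀ y → 1 ≡ 1 + y * (0 + y * 0)
  base = solve-∀
[1+y]^n≡1+y[n+yh] y (suc n) =
  let h , eq = [1+y]^n≡1+y[n+yh] y n
  in h + n + y * h , trans (cong ((1 + y) *_) eq) (step y n h)
  where
  step : ∀ y n h → (1 + y) * (1 + y * (n + y * h)) ≡ 1 + y * (1 + n + y * (h + n + y * h))
  step = solve-∀

≡1[mod]-lift : ∀ {M j a} → a ≡1[mod M ^ suc j ] → a ^ M ≡1[mod M ^ suc (suc j) ]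
≡1[mod]-lift {M} {j} (t , refl) =
  let h , eq = [1+y]^n≡1+y[n+yh] (M ^ suc j * t) M
  in t * (1 + M ^ j * t * h) , trans eq (regroup M (M ^ j) t h)
  where
  regroup : ∀ M X t h → 1 + M * X * t * (M + M * X * t * h) ≡ 1 + M * (M * X) * (t * (1 + X * t * h))
  regroup = solve-∀

≡1[mod]-lift^ : ∀ {M a} → a ≡1[mod M ] → ∀ k → a ^ (M ^ k) ≡1[mod M ^ suc k ]
≡1[mod]-lift^ {M} (t , refl) zero = t , regroup M t
  where
  regroup : ∀ M t → (1 + M * t) * 1 ≡ 1 + M * 1 * t
  regroup = solve-∀
≡1[mod]-lift^ {M} {a} a≡1 (suc k) =
  subst (_≡1[mod M ^ suc (suc k) ])
        (trans (^-*-assoc a (M ^ k) M) (cong (a ^_) (*-comm (M ^ k) M)))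
        (≡1[mod]-lift {M} {k} (≡1[mod]-lift^ a≡1 k))

coprime-* : ∀ {a b n} → Coprime a n → Coprime b n → Coprime (a * b) n
coprime-* {a} a⊥n b⊥n (d∣ab , d∣n) = b⊥n (Coprime.coprime-divisor d⊥a d∣ab , d∣n)
  where
  d⊥a : Coprime _ a
  d⊥a (e∣d , e∣a) = a⊥n (e∣a , ∣-trans e∣d d∣n)

coprime-*⇒coprimeʳ : ∀ {a b n} → Coprime (a * b) n → Coprime b n
coprime-*⇒coprimeʳ {a} ab⊥n (d∣b , d∣n) = ab⊥n (∣n⇒∣m*n a d∣b , d∣n)

applyUpTo≡tabulate : ∀ {A : Set} (f : ℕ → A) n → applyUpTo f n ≡ tabulate {n = n} (f ∘ toℕ)
applyUpTo≡tabulate f zero    = refl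
applyUpTo≡tabulate f (suc n) = cong (f 0 ∷_) (applyUpTo≡tabulate (f ∘ suc) n)

∏-*-^ : ∀ {n} x (f g : Fin n → ℕ) → ∏ (λ i → g i * x ^ f i) ≡ ∏ g * x ^ sum f
∏-*-^ {zero}  x f g = refl
∏-*-^ {suc n} x f g = begin
  g₀ * x ^ f₀ * ∏ (λ i → g (Fin.suc i) * x ^ f (Fin.suc i))
    ≡⟨ cong (g₀ * x ^ f₀ *_) (∏-*-^ x (f ∘ Fin.suc) (g ∘ Fin.suc)) ⟩
  g₀ * x ^ f₀ * (∏ (g ∘ Fin.suc) * x ^ sum (f ∘ Fin.suc))
    ≡⟨ swap g₀ (x ^ f₀) _ _ ⟩
  g₀ * ∏ (g ∘ Fin.suc) * (x ^ f₀ * x ^ sum (f ∘ Fin.suc))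
    ≡⟨ cong (∏ g *_) (^-distribˡ-+-* x f₀ _) ⟨
  ∏ g * x ^ sum f ∎
  where
  open ≡-Reasoning
  f₀ = f Fin.zero
  g₀ = g Fin.zero
  swap : ∀ a b c d → a * b * (c * d) ≡ a * c * (b * d)
  swap = solve-∀

-- Euler's theorem

module _ {M : ℕ} .{{_ : NonZero M}} where

  %-cong-* : ∀ {a b c d} → a % M ≡ b % M → c % M ≡ d % M → (a * c) % M ≡ (b * d) % M
  %-cong-* {a} {b} {c} {d} a≡b c≡d = begin
    (a * c) % M             ≡⟨ %-distribˡ-* a c M ⟩
    (a % M * (c % M)) % M   ≡⟨ cong₂ (λ u v → (u * v) % M) a≡b c≡d ⟩
    (b % M * (d % M)) % M   ≡⟨ %-distribˡ-* b d M ⟨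
    (b * d) % M             ∎
    where open ≡-Reasoning

  m%M≡n%M⇒M∣m∸n : ∀ m n → m % M ≡ n % M → M ∣ m ∸ n
  m%M≡n%M⇒M∣m∸n m n m≡n = divides (m / M ∸ n / M) (begin
    m ∸ n                                   ≡⟨ cong₂ _∸_ (m≡m%n+[m/n]*n m M) (m≡m%n+[m/n]*n n M) ⟩
    (m % M + m / M * M) ∸ (n % M + n / M * M) ≡⟨ cong (λ r → (r + m / M * M) ∸ (n % M + n / M * M)) m≡n ⟩
    (n % M + m / M * M) ∸ (n % M + n / M * M) ≡⟨ [m+n]∸[m+o]≡n∸o (n % M) (m / M * M) (n / M * M) ⟩
    m / M * M ∸ n / M * M                   ≡⟨ *-distribʳ-∸ M (m / M) (n / M) ⟨
    (m / M ∸ n / M) * M                     ∎)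
    where open ≡-Reasoning

  ∏-cong-% : ∀ {n} (f g : Fin n → ℕ) → (∀ i → f i % M ≡ g i % M) → ∏ f % M ≡ ∏ g % M
  ∏-cong-% {zero}  f g f≡g = refl
  ∏-cong-% {suc n} f g f≡g = %-cong-* (f≡g Fin.zero) (∏-cong-% (f ∘ Fin.suc) (g ∘ Fin.suc) (f≡g ∘ Fin.suc))

  ∏-coprime : ∀ {n} (f : Fin n → ℕ) → (∀ i → Coprime (f i) M) → Coprime (∏ f) M
  ∏-coprime {zero}  f f⊥M = Coprime.1-coprimeTo M
  ∏-coprime {suc n} f f⊥M = coprime-* (f⊥M Fin.zero) (∏-coprime (f ∘ Fin.suc) (f⊥M ∘ Fin.suc))

  coprime⇒coprime-% : ∀ {a} → Coprime a M → Coprime (a % M) M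
  coprime⇒coprime-% a⊥M (d∣a%M , d∣M) = a⊥M (∣n∣m%n⇒∣m d∣M d∣a%M , d∣M)

  coprime-%⇒coprime : ∀ {a} → Coprime (a % M) M → Coprime a M
  coprime-%⇒coprime a%M⊥M (d∣a , d∣M) = a%M⊥M (%-presˡ-∣ d∣a d∣M , d∣M)

  coprime⇒*-cancelˡ-% : ∀ {c a b} → Coprime c M → (c * a) % M ≡ (c * b) % M → M ∣ a ∸ b
  coprime⇒*-cancelˡ-% {c} {a} {b} c⊥M ca≡cb = Coprime.coprime-divisor (Coprime.sym c⊥M)
    (subst (M ∣_) (sym (*-distribˡ-∸ c a b)) (m%M≡n%M⇒M∣m∸n (c * a) (c * b) ca≡cb))

  inverse-mod : ∀ {x} → Coprime x M → ∃[ y ] (y * x) % M ≡ 1 % M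
  inverse-mod {x} x⊥M with Coprime.coprime-Bézout x⊥M
  ... | Bézout.+- a b 1+bM≡ax = a , (begin
    (a * x) % M     ≡⟨ cong (_% M) 1+bM≡ax ⟨
    (1 + b * M) % M ≡⟨ [m+kn]%n≡m%n 1 b M ⟩
    1 % M           ∎)
    where open ≡-Reasoning
  -- Here a x ≡ -1 (mod M), so (a x)² ≡ 1.
  ... | Bézout.-+ a b 1+ax≡bM = a * x * a , (begin
    (a * x * a * x) % M                      ≡⟨ cong (_% M) (*-assoc (a * x) a x) ⟩
    (a * x * (a * x)) % M                    ≡⟨ %-remove-+ʳ _ (∣n⇒∣m*n 2 (n∣m*n b)) ⟨
    (a * x * (a * x) + 2 * (b * M)) % M      ≡⟨ cong (_% M) (square (a * x) 1+ax≡bM) ⟩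
    (1 + b * M * (b * M)) % M                ≡⟨ %-remove-+ʳ 1 (∣n⇒∣m*n (b * M) (n∣m*n b)) ⟩
    1 % M                                    ∎)
    where
    open ≡-Reasoning
    expand : ∀ u → u * u + 2 * (1 + u) ≡ 1 + (1 + u) * (1 + u)
    expand = solve-∀
    square : ∀ u {v} → 1 + u ≡ v → u * u + 2 * v ≡ 1 + v * v
    square u refl = expand u

  mulMod : ℕ → Fin M → Fin M
  mulMod x i = fromℕ< (m%n<n (x * toℕ i) M)

  toℕ-mulMod : ∀ x i → toℕ (mulMod x i) ≡ (x * toℕ i) % M
  toℕ-mulMod x i = Fin.toℕ-fromℕ< (m%n<n (x * toℕ i) M)

  mulMod-inverse : ∀ {x y} → (y * x) % M ≡ 1 % M → ∀ i → mulMod y (mulMod x i) ≡ i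
  mulMod-inverse {x} {y} yx≡1 i = Fin.toℕ-injective (begin
    toℕ (mulMod y (mulMod x i))  ≡⟨ toℕ-mulMod y (mulMod x i) ⟩
    (y * toℕ (mulMod x i)) % M   ≡⟨ %-cong-* {y} {y} refl (trans (cong (_% M) (toℕ-mulMod x i)) (m%n%n≡m%n _ M)) ⟩
    (y * (x * toℕ i)) % M        ≡⟨ cong (_% M) (*-assoc y x (toℕ i)) ⟨
    (y * x * toℕ i) % M          ≡⟨ %-cong-* {c = toℕ i} yx≡1 refl ⟩
    (1 * toℕ i) % M              ≡⟨ cong (_% M) (*-identityˡ (toℕ i)) ⟩
    toℕ i % M                    ≡⟨ m<n⇒m%n≡m (Fin.toℕ<n i) ⟩
    toℕ i                        ∎)
    where open ≡-Reasoning

  mulMod-permutation : ∀ {x} → Coprime x M → Permutation M M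
  mulMod-permutation {x} x⊥M =
    let y , yx≡1 = inverse-mod x⊥M
    in permutation (mulMod x) (mulMod y)
         (mulMod-inverse {y} {x} (trans (cong (_% M) (*-comm x y)) yx≡1)) (mulMod-inverse {x} {y} yx≡1)

  coprimeTo? : ∀ a → Dec (Coprime a M)
  coprimeTo? a = Coprime.coprime? a M

  isUnit : ℕ → ℕ
  isUnit a with coprimeTo? a
  ... | yes _ = 1
  ... | no  _ = 0

  unitPart : ℕ → ℕ
  unitPart a with coprimeTo? a
  ... | yes _ = a
  ... | no  _ = 1

  unitPart-coprime : ∀ a → Coprime (unitPart a) M
  unitPart-coprime a with coprimeTo? a
  ... | yes a⊥M = a⊥M
  ... | no  _   = Coprime.1-coprimeTo M

  unitPart-* : ∀ {x} → Coprime x M → ∀ a → unitPart ((x * a) % M) % M ≡ (unitPart a * x ^ isUnit a) % M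
  unitPart-* {x} x⊥M a with coprimeTo? ((x * a) % M) | coprimeTo? a
  ... | yes _     | yes _   =
    trans (m%n%n≡m%n (x * a) M) (cong (_% M) (trans (*-comm x a) (cong (a *_) (sym (*-identityʳ x)))))
  ... | no  _     | no  _   = refl
  ... | yes xa⊥M  | no  a⊥̸M = ⊥-elim (a⊥̸M (coprime-*⇒coprimeʳ {x} (coprime-%⇒coprime xa⊥M)))
  ... | no  xa⊥̸M | yes a⊥M = ⊥-elim (xa⊥̸M (coprime⇒coprime-% (coprime-* x⊥M a⊥M)))

  units : List ℕ → ℕ
  units xs = length (filter coprimeTo? xs)

  units-∷ : ∀ a xs → units (a ∷ xs) ≡ isUnit a + units xs
  units-∷ a xs with coprimeTo? a
  ... | yes a⊥M = cong length (filter-accept coprimeTo? a⊥M)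
  ... | no  a⊥̸M = cong length (filter-reject coprimeTo? a⊥̸M)

  units-∷ʳ : ∀ xs a → units (xs ∷ʳ a) ≡ units xs + isUnit a
  units-∷ʳ xs a = begin
    units (xs ∷ʳ a)           ≡⟨ cong length (filter-++ coprimeTo? xs [ a ]) ⟩
    length (filter coprimeTo? xs ++ filter coprimeTo? [ a ]) ≡⟨ length-++ (filter coprimeTo? xs) ⟩
    units xs + units [ a ]    ≡⟨ cong (units xs +_) (trans (units-∷ a []) (+-identityʳ (isUnit a))) ⟩
    units xs + isUnit a       ∎
    where open ≡-Reasoning

  units-tabulate : ∀ {n} (f : Fin n → ℕ) → units (tabulate f) ≡ ∑[ i < n ] isUnit (f i)
  units-tabulate {zero}  f = refl
  units-tabulate {suc n} f = trans (units-∷ (f Fin.zero) _) (cong (isUnit (f Fin.zero) +_) (units-tabulate (f ∘ Fin.suc)))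

  -- totient counts the residues 1, …, M instead of 0, …, M - 1; this makes no difference
  -- because 0 and M are coprime to M exactly when M = 1.
  isUnit-M≡isUnit-0 : isUnit M ≡ isUnit 0
  isUnit-M≡isUnit-0 with coprimeTo? M | coprimeTo? 0
  ... | yes _   | yes _   = refl
  ... | no  _   | no  _   = refl
  ... | yes M⊥M | no  0⊥̸M = ⊥-elim (0⊥̸M (λ (_ , d∣M) → M⊥M (d∣M , d∣M)))
  ... | no  M⊥̸M | yes 0⊥M = ⊥-elim (M⊥̸M (λ (d∣M , _) → 0⊥M (_ ∣0 , d∣M)))

  totient≡units-upTo : totient M ≡ units (upTo M)
  totient≡units-upTo = +-cancelˡ-≡ (isUnit M) _ _ (begin
    isUnit M + totient M       ≡⟨ cong (_+ totient M) isUnit-M≡isUnit-0 ⟩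
    isUnit 0 + totient M       ≡⟨ units-∷ 0 (map suc (upTo M)) ⟨
    units (0 ∷ map suc (upTo M)) ≡⟨ cong (λ xs → units (0 ∷ xs)) (map-upTo suc M) ⟩
    units (upTo (suc M))       ≡⟨ cong units (upTo-∷ʳ M) ⟨
    units (upTo M ∷ʳ M)        ≡⟨ units-∷ʳ (upTo M) M ⟩
    units (upTo M) + isUnit M  ≡⟨ +-comm (units (upTo M)) (isUnit M) ⟩
    isUnit M + units (upTo M)  ∎)
    where open ≡-Reasoning

  ∏unitPart : ℕ
  ∏unitPart = ∏ {M} (unitPart ∘ toℕ)

  -- Multiplication by x permutes the residues modulo M; each unit picks up a factor x.
  ∏unitPart-* : ∀ {x} → Coprime x M → (∏unitPart * x ^ totient M) % M ≡ ∏unitPart % M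
  ∏unitPart-* {x} x⊥M = sym (begin
    ∏unitPart % M
      ≡⟨ cong (_% M) (∏-permute (unitPart ∘ toℕ) (mulMod-permutation x⊥M)) ⟩
    ∏ (unitPart ∘ toℕ ∘ mulMod x) % M
      ≡⟨ ∏-cong-% (unitPart ∘ toℕ ∘ mulMod x) unitPart*x^isUnit unitPart-mulMod ⟩
    ∏ unitPart*x^isUnit % M
      ≡⟨ cong (_% M) (∏-*-^ {M} x (isUnit ∘ toℕ) (unitPart ∘ toℕ)) ⟩
    (∏unitPart * x ^ (∑[ i < M ] isUnit (toℕ i))) % M
      ≡⟨ cong (λ c → (∏unitPart * x ^ c) % M) units≡totient ⟩
    (∏unitPart * x ^ totient M) % M ∎)
    where
    open ≡-Reasoning
    unitPart*x^isUnit : Fin M → ℕ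
    unitPart*x^isUnit i = unitPart (toℕ i) * x ^ isUnit (toℕ i)
    unitPart-mulMod : ∀ i → unitPart (toℕ (mulMod x i)) % M ≡ unitPart*x^isUnit i % M
    unitPart-mulMod i = trans (cong (λ a → unitPart a % M) (toℕ-mulMod x i)) (unitPart-* x⊥M (toℕ i))
    units≡totient : ∑[ i < M ] isUnit (toℕ i) ≡ totient M
    units≡totient = sym (begin
      totient M                    ≡⟨ totient≡units-upTo ⟩
      units (upTo M)               ≡⟨ cong units (applyUpTo≡tabulate (λ a → a) M) ⟩
      units (tabulate {n = M} toℕ) ≡⟨ units-tabulate {M} toℕ ⟩
      ∑[ i < M ] isUnit (toℕ i)    ∎)

  euler : ∀ {x} .{{_ : NonZero x}} → Coprime x M → x ^ totient M ≡1[mod M ]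
  euler {x} x⊥M = quotient M∣x^φ∸1 , (begin
    x ^ φ                   ≡⟨ m+[n∸m]≡n (m^n>0 x φ) ⟨
    1 + (x ^ φ ∸ 1)         ≡⟨ cong (1 +_) (m∣n⇒n≡m*quotient M∣x^φ∸1) ⟩
    1 + M * quotient M∣x^φ∸1 ∎)
    where
    open ≡-Reasoning
    φ = totient M
    M∣x^φ∸1 : M ∣ x ^ φ ∸ 1
    M∣x^φ∸1 = coprime⇒*-cancelˡ-% (∏-coprime {M} (unitPart ∘ toℕ) (unitPart-coprime ∘ toℕ))
                (trans (∏unitPart-* x⊥M) (cong (_% M) (sym (*-identityʳ ∏unitPart))))

  euler-lift : ∀ {x} .{{_ : NonZero x}} → Coprime x M → ∀ c k → x ^ (totient M * c * M ^ k) ≡1[mod M ^ suc k ]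
  euler-lift {x} x⊥M c k =
    subst (_≡1[mod M ^ suc k ])
          (trans (cong (_^ M ^ k) (^-*-assoc x (totient M) c)) (^-*-assoc x (totient M * c) (M ^ k)))
          (≡1[mod]-lift^ (≡1[mod]-^ (euler x⊥M) c) k)

-- Radical inverses

ℕ→ℚ≡mkℚ : ∀ n → ℕ→ℚ n ≡ mkℚ (ℤ.+ n) 0 (Coprime.sym (Coprime.1-coprimeTo n))
ℕ→ℚ≡mkℚ n = ℚ.normalize-coprime (Coprime.sym (Coprime.1-coprimeTo n))

recip≡mkℚ : ∀ n → recip (suc n) ≡ mkℚ (ℤ.+ 1) n (Coprime.1-coprimeTo (suc n))
recip≡mkℚ n = ℚ.normalize-coprime (Coprime.1-coprimeTo (suc n))

ℕ→ℚ-homo-+ : ∀ m n → ℕ→ℚ (m + n) ≡ ℕ→ℚ m +ℚ ℕ→ℚ n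
ℕ→ℚ-homo-+ m n rewrite ℕ→ℚ≡mkℚ m | ℕ→ℚ≡mkℚ n | ℤ.*-identityʳ (ℤ.+ m) | ℤ.*-identityʳ (ℤ.+ n) =
  refl

ℕ→ℚ-mono-≤ : ∀ {m n} → m ≤ n → ℕ→ℚ m ≤ℚ ℕ→ℚ n
ℕ→ℚ-mono-≤ {m} {n} m≤n rewrite ℕ→ℚ≡mkℚ m | ℕ→ℚ≡mkℚ n =
  *≤* (subst₂ ℤ._≤_ (sym (ℤ.*-identityʳ (ℤ.+ m))) (sym (ℤ.*-identityʳ (ℤ.+ n))) (ℤ.+≤+ m≤n))

ℕ→ℚ*recip≡1 : ∀ n .{{_ : NonZero n}} → ℕ→ℚ n *ℚ recip n ≡ 1ℚ
ℕ→ℚ*recip≡1 (suc n) rewrite ℕ→ℚ≡mkℚ (suc n) | recip≡mkℚ n =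
  ℚ.*-inverseʳ (mkℚ (ℤ.+ suc n) 0 (Coprime.sym (Coprime.1-coprimeTo (suc n))))

recip-homo-* : ∀ m n .{{_ : NonZero m}} .{{_ : NonZero n}} → recip (m * n) ≡ recip m *ℚ recip n
recip-homo-* (suc m) (suc n) rewrite recip≡mkℚ m | recip≡mkℚ n = refl

0≤recip : ∀ n → 0ℚ ≤ℚ recip n
0≤recip zero    = ℚ.≤-refl
0≤recip (suc n) = ℚ.nonNegative⁻¹ _ {{ℚ.normalize-nonNeg 1 (suc n)}}

0≤p*q : ∀ {p q} → 0ℚ ≤ℚ p → 0ℚ ≤ℚ q → 0ℚ ≤ℚ p *ℚ q
0≤p*q {p} {q} 0≤p 0≤q =
  ℚ.nonNegative⁻¹ _ {{ℚ.nonNeg*nonNeg⇒nonNeg p {{nonNegative 0≤p}} q {{nonNegative 0≤q}}}}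

∣p-q∣≤1 : ∀ {p q} → 0ℚ ≤ℚ p → p ≤ℚ 1ℚ → 0ℚ ≤ℚ q → q ≤ℚ 1ℚ → ∣ p - q ∣ ≤ℚ 1ℚ
∣p-q∣≤1 {p} {q} 0≤p p≤1 0≤q q≤1 with ℚ.∣p∣≡p∨∣p∣≡-p (p - q)
... | inj₁ ∣p-q∣≡p-q = begin
  ∣ p - q ∣  ≡⟨ ∣p-q∣≡p-q ⟩
  p - q      ≤⟨ ℚ.+-mono-≤ p≤1 (ℚ.neg-antimono-≤ 0≤q) ⟩
  1ℚ - 0ℚ    ∎
  where open ℚ.≤-Reasoning
... | inj₂ ∣p-q∣≡q-p = begin
  ∣ p - q ∣  ≡⟨ ∣p-q∣≡q-p ⟩
  - (p - q)  ≡⟨ neg-[p-q] p q ⟩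
  q - p      ≤⟨ ℚ.+-mono-≤ q≤1 (ℚ.neg-antimono-≤ 0≤p) ⟩
  1ℚ - 0ℚ    ∎
  where
  open ℚ.≤-Reasoning
  open +-*-Solver
  neg-[p-q] : ∀ p q → - (p - q) ≡ q - p
  neg-[p-q] = solve 2 (λ p q → :- (p :- q) := q :- p) refl

module RadicalInverse (b : ℕ) where

  B : ℕ
  B = 2 + b

  recip-B^suc : ∀ n → recip (B * B ^ n) ≡ recip B *ℚ recip (B ^ n)
  recip-B^suc n = recip-homo-* B (B ^ n) {{_}} {{m^n≢0 B n}}

  recip-B^-+ : ∀ i j → recip (B ^ (i + j)) ≡ recip (B ^ i) *ℚ recip (B ^ j)
  recip-B^-+ i j = trans (cong recip (^-distribˡ-+-* B i j)) (recip-homo-* (B ^ i) (B ^ j) {{m^n≢0 B i}} {{m^n≢0 B j}})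

  recip-B^[i+1] : ∀ i → recip (B ^ (i + 1)) ≡ recip (B ^ i) *ℚ recip B
  recip-B^[i+1] i = trans (recip-B^-+ i 1) (cong (λ z → recip (B ^ i) *ℚ recip z) (*-identityʳ B))

  [1+[B∸1]]*recip[B]≡1 : (1ℚ +ℚ ℕ→ℚ (suc b)) *ℚ recip B ≡ 1ℚ
  [1+[B∸1]]*recip[B]≡1 = trans (cong (_*ℚ recip B) (sym (ℕ→ℚ-homo-+ 1 (suc b)))) (ℕ→ℚ*recip≡1 B)

  radInvAux-0 : ∀ f → radInvAux b f 0 ≡ 0ℚ
  radInvAux-0 zero    = refl
  radInvAux-0 (suc f) = trans (cong (λ r → (0ℚ +ℚ r) *ℚ recip B) (radInvAux-0 f)) (ℚ.*-zeroˡ (recip B))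

  radInvAux-fuel-irrelevant : ∀ {x F G} → x ≤ F → x ≤ G → radInvAux b F x ≡ radInvAux b G x
  radInvAux-fuel-irrelevant {F = zero}  {G}      z≤n _   = sym (radInvAux-0 G)
  radInvAux-fuel-irrelevant {F = suc F} {zero}   _   z≤n = radInvAux-0 (suc F)
  radInvAux-fuel-irrelevant {x} {suc F} {suc G} x≤F x≤G =
    cong (λ r → (ℕ→ℚ (x % B) +ℚ r) *ℚ recip B) (radInvAux-fuel-irrelevant (/B-≤ x≤F) (/B-≤ x≤G))
    where
    /B-≤ : ∀ {x F} → x ≤ suc F → x / B ≤ F
    /B-≤ {zero}  _   = z≤n
    /B-≤ {suc x} x≤F = s≤s⁻¹ (<-≤-trans (m/n<m (suc x) B (s≤s (s≤s z≤n))) x≤F)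

  0≤radInvAux : ∀ f n → 0ℚ ≤ℚ radInvAux b f n
  0≤radInvAux zero    n = ℚ.≤-refl
  0≤radInvAux (suc f) n =
    0≤p*q (ℚ.+-mono-≤ (ℕ→ℚ-mono-≤ {n = n % B} z≤n) (0≤radInvAux f (n / B))) (0≤recip B)

  radInvAux≤1 : ∀ f n → radInvAux b f n ≤ℚ 1ℚ
  radInvAux≤1 zero    n = ℕ→ℚ-mono-≤ {0} {1} z≤n
  radInvAux≤1 (suc f) n = begin
    (ℕ→ℚ (n % B) +ℚ radInvAux b f (n / B)) *ℚ recip B
      ≤⟨ ℚ.*-monoʳ-≤-nonNeg (recip B) {{nonNegative (0≤recip B)}}
           (ℚ.+-mono-≤ (ℕ→ℚ-mono-≤ (s≤s⁻¹ (m%n<n n B))) (radInvAux≤1 f (n / B))) ⟩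
    (ℕ→ℚ (suc b) +ℚ 1ℚ) *ℚ recip B  ≡⟨ cong (_*ℚ recip B) (ℚ.+-comm (ℕ→ℚ (suc b)) 1ℚ) ⟩
    (1ℚ +ℚ ℕ→ℚ (suc b)) *ℚ recip B  ≡⟨ [1+[B∸1]]*recip[B]≡1 ⟩
    1ℚ                              ∎
    where open ℚ.≤-Reasoning

  0≤radInv : ∀ n → 0ℚ ≤ℚ radInv B n
  0≤radInv n = 0≤radInvAux (suc n) n

  radInv≤1 : ∀ n → radInv B n ≤ℚ 1ℚ
  radInv≤1 n = radInvAux≤1 (suc n) n

  radInv-step : ∀ n → radInv B n ≡ (ℕ→ℚ (n % B) +ℚ radInv B (n / B)) *ℚ recip B
  radInv-step n =
    cong (λ r → (ℕ→ℚ (n % B) +ℚ r) *ℚ recip B) (radInvAux-fuel-irrelevant (m/n≤m n B) (n≤1+n (n / B)))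

  radInv-+*B : ∀ n k → radInv B (n + k * B) ≡ (ℕ→ℚ (n % B) +ℚ radInv B (n / B + k)) *ℚ recip B
  radInv-+*B n k = trans (radInv-step (n + k * B))
    (cong₂ (λ i j → (ℕ→ℚ i +ℚ radInv B j) *ℚ recip B) ([m+kn]%n≡m%n n k B)
           (trans (+-distrib-/-∣ʳ n (n∣m*n k)) (cong (n / B +_) (m*n/n≡m k B))))

  radInv-digit : ∀ {d} → d < B → ∀ x → radInv B (d + x * B) ≡ (ℕ→ℚ d +ℚ radInv B x) *ℚ recip B
  radInv-digit {d} d<B x = trans (radInv-+*B d x)
    (cong₂ (λ i j → (ℕ→ℚ i +ℚ radInv B (j + x)) *ℚ recip B) (m<n⇒m%n≡m d<B) (m<n⇒m/n≡0 d<B))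

  radInv-*B^ : ∀ x a → radInv B (x * B ^ a) ≡ radInv B x *ℚ recip (B ^ a)
  radInv-*B^ x zero    = trans (cong (radInv B) (*-identityʳ x)) (sym (ℚ.*-identityʳ (radInv B x)))
  radInv-*B^ x (suc a) = begin
    radInv B (x * (B * B ^ a))                     ≡⟨ cong (radInv B) (regroup x (B ^ a) b) ⟩
    radInv B (0 + x * B ^ a * B)                   ≡⟨ radInv-digit z<s (x * B ^ a) ⟩
    (0ℚ +ℚ radInv B (x * B ^ a)) *ℚ recip B        ≡⟨ cong (λ r → (0ℚ +ℚ r) *ℚ recip B) (radInv-*B^ x a) ⟩
    (0ℚ +ℚ radInv B x *ℚ recip (B ^ a)) *ℚ recip B ≡⟨ reassoc (radInv B x) (recip (B ^ a)) (recip B) ⟩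
    radInv B x *ℚ (recip B *ℚ recip (B ^ a))       ≡⟨ cong (radInv B x *ℚ_) (recip-B^suc a) ⟨
    radInv B x *ℚ recip (B * B ^ a)                ∎
    where
    open ≡-Reasoning
    regroup : ∀ x y b → x * ((2 + b) * y) ≡ 0 + x * y * (2 + b)
    regroup = solve-∀
    open +-*-Solver
    reassoc : ∀ r s u → (0ℚ +ℚ r *ℚ s) *ℚ u ≡ r *ℚ (u *ℚ s)
    reassoc = solve 3 (λ r s u → (con 0ℚ :+ r :* s) :* u := r :* (u :* s)) refl

  radInv-B^∸1 : ∀ k → radInv B (B ^ k ∸ 1) ≡ 1ℚ - recip (B ^ k)
  radInv-B^∸1 zero    = radInvAux-0 1
  radInv-B^∸1 (suc k) = begin
    radInv B (B * B ^ k ∸ 1)                   ≡⟨ cong (λ y → radInv B (B * y ∸ 1)) 1+w≡B^k ⟨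
    radInv B (B * (1 + w) ∸ 1)                 ≡⟨ cong (λ y → radInv B (y ∸ 1)) (expand b w) ⟩
    radInv B (suc b + w * B)                   ≡⟨ radInv-digit ≤-refl w ⟩
    (ℕ→ℚ (suc b) +ℚ radInv B w) *ℚ recip B
      ≡⟨ cong (λ r → (ℕ→ℚ (suc b) +ℚ r) *ℚ recip B) (radInv-B^∸1 k) ⟩
    (ℕ→ℚ (suc b) +ℚ (1ℚ - c)) *ℚ recip B       ≡⟨ regroup (ℕ→ℚ (suc b)) c (recip B) ⟩
    (1ℚ +ℚ ℕ→ℚ (suc b)) *ℚ recip B - recip B *ℚ c
      ≡⟨ cong₂ _-_ [1+[B∸1]]*recip[B]≡1 (sym (recip-B^suc k)) ⟩
    1ℚ - recip (B * B ^ k)                     ∎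
    where
    open ≡-Reasoning
    w = B ^ k ∸ 1
    c = recip (B ^ k)
    1+w≡B^k : 1 + w ≡ B ^ k
    1+w≡B^k = m+[n∸m]≡n (m^n>0 B k)
    expand : ∀ b w → (2 + b) * (1 + w) ≡ 1 + (1 + b + w * (2 + b))
    expand = solve-∀
    open +-*-Solver
    regroup : ∀ d c u → (d +ℚ (1ℚ - c)) *ℚ u ≡ (1ℚ +ℚ d) *ℚ u - u *ℚ c
    regroup = solve 3 (λ d c u → (d :+ (con 1ℚ :- c)) :* u := (con 1ℚ :+ d) :* u :- u :* c) refl

  radInv-close : ∀ n N t → ∣ radInv B n - radInv B (n + t * B ^ N) ∣ ≤ℚ recip (B ^ N)
  radInv-close n zero    t = ∣p-q∣≤1 (0≤radInv n) (radInv≤1 n) (0≤radInv (n + t * 1)) (radInv≤1 (n + t * 1))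
  radInv-close n (suc N) t = begin
    ∣ radInv B n - radInv B (n + t * (B * B ^ N)) ∣
      ≡⟨ cong (λ y → ∣ radInv B n - radInv B (n + y) ∣) (regroup t (B ^ N) b) ⟩
    ∣ radInv B n - radInv B (n + t * B ^ N * B) ∣
      ≡⟨ cong₂ (λ p q → ∣ p - q ∣) (radInv-step n) (radInv-+*B n (t * B ^ N)) ⟩
    ∣ (d +ℚ p) *ℚ u - (d +ℚ q) *ℚ u ∣   ≡⟨ cong ∣_∣ (factor d p q u) ⟩
    ∣ u *ℚ (p - q) ∣                    ≡⟨ ℚ.∣p*q∣≡∣p∣*∣q∣ u (p - q) ⟩
    ∣ u ∣ *ℚ ∣ p - q ∣                  ≡⟨ cong (_*ℚ ∣ p - q ∣) (ℚ.0≤p⇒∣p∣≡p (0≤recip B)) ⟩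
    u *ℚ ∣ p - q ∣
      ≤⟨ ℚ.*-monoˡ-≤-nonNeg u {{nonNegative (0≤recip B)}} (radInv-close (n / B) N t) ⟩
    u *ℚ recip (B ^ N)                  ≡⟨ recip-B^suc N ⟨
    recip (B * B ^ N)                   ∎
    where
    open ℚ.≤-Reasoning
    d = ℕ→ℚ (n % B)
    p = radInv B (n / B)
    q = radInv B (n / B + t * B ^ N)
    u = recip B
    regroup : ∀ t y b → t * ((2 + b) * y) ≡ t * y * (2 + b)
    regroup = solve-∀
    open +-*-Solver
    factor : ∀ d p q u → (d +ℚ p) *ℚ u - (d +ℚ q) *ℚ u ≡ u *ℚ (p - q)
    factor = solve 4 (λ d p q u → (d :+ p) :* u :- (d :+ q) :* u := u :* (p :- q)) refl

  radInv-[B^k∸1]*B^[ℓ+1] : ∀ ℓ k →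
    radInv B ((B ^ k ∸ 1) * B ^ (ℓ + 1)) ≡ (1ℚ - recip (B ^ k)) *ℚ (recip (B ^ ℓ) *ℚ recip B)
  radInv-[B^k∸1]*B^[ℓ+1] ℓ k =
    trans (radInv-*B^ (B ^ k ∸ 1) (ℓ + 1)) (cong₂ _*ℚ_ (radInv-B^∸1 k) (recip-B^[i+1] ℓ))

  radInv-[1+s*B^k*B]*B^ℓ : ∀ ℓ k s →
    radInv B ((1 + s * B ^ k * B) * B ^ ℓ) ≡ (1ℚ +ℚ radInv B s *ℚ recip (B ^ k)) *ℚ recip B *ℚ recip (B ^ ℓ)
  radInv-[1+s*B^k*B]*B^ℓ ℓ k s = begin
    radInv B ((1 + s * B ^ k * B) * B ^ ℓ)          ≡⟨ radInv-*B^ (1 + s * B ^ k * B) ℓ ⟩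
    radInv B (1 + s * B ^ k * B) *ℚ recip (B ^ ℓ)
      ≡⟨ cong (_*ℚ recip (B ^ ℓ)) (radInv-digit (s≤s (s≤s z≤n)) (s * B ^ k)) ⟩
    (1ℚ +ℚ radInv B (s * B ^ k)) *ℚ recip B *ℚ recip (B ^ ℓ)
      ≡⟨ cong (λ z → (1ℚ +ℚ z) *ℚ recip B *ℚ recip (B ^ ℓ)) (radInv-*B^ s k) ⟩
    (1ℚ +ℚ radInv B s *ℚ recip (B ^ k)) *ℚ recip B *ℚ recip (B ^ ℓ) ∎
    where open ≡-Reasoning

  radInv-carry : ∀ ℓ k {P} → P ≡1[mod B ^ suc k ] →
    ∣ radInv B ((B ^ k ∸ 1) * B ^ (ℓ + 1)) - radInv B ((B ^ k ∸ 1) * B ^ (ℓ + 1) + (B + 1) * B ^ ℓ * P) ∣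
      ≤ℚ ℕ→ℚ 2 *ℚ recip (B ^ (ℓ + k + 1))
  radInv-carry ℓ k (t , refl) = let open ℚ.≤-Reasoning in begin
    ∣ radInv B n - radInv B m ∣
      ≡⟨ cong₂ (λ p q → ∣ p - q ∣) (radInv-[B^k∸1]*B^[ℓ+1] ℓ k)
               (trans (cong (radInv B) m≡) (radInv-[1+s*B^k*B]*B^ℓ ℓ k s)) ⟩
    ∣ (1ℚ - c) *ℚ (a *ℚ u) - (1ℚ +ℚ y *ℚ c) *ℚ u *ℚ a ∣   ≡⟨ cong ∣_∣ (difference a c u y) ⟩
    ∣ - ((1ℚ +ℚ y) *ℚ (a *ℚ c *ℚ u)) ∣                    ≡⟨ cong (λ z → ∣ - ((1ℚ +ℚ y) *ℚ z) ∣) r≡acu ⟨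
    ∣ - ((1ℚ +ℚ y) *ℚ r) ∣                                ≡⟨ ℚ.∣-p∣≡∣p∣ _ ⟩
    ∣ (1ℚ +ℚ y) *ℚ r ∣                                    ≡⟨ ℚ.0≤p⇒∣p∣≡p (0≤p*q 0≤1+y 0≤r) ⟩
    (1ℚ +ℚ y) *ℚ r                                        ≤⟨ ℚ.*-monoʳ-≤-nonNeg r {{nonNegative 0≤r}}
                                                               (ℚ.+-monoʳ-≤ 1ℚ (radInv≤1 s)) ⟩
    ℕ→ℚ 2 *ℚ r                                            ∎
    where
    w = B ^ k ∸ 1
    s = 1 + (B + 1) * t
    n = w * B ^ (ℓ + 1)
    m = n + (B + 1) * B ^ ℓ * (1 + B ^ suc k * t)
    a = recip (B ^ ℓ)
    c = recip (B ^ k)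
    u = recip B
    y = radInv B s
    r = recip (B ^ (ℓ + k + 1))
    0≤r : 0ℚ ≤ℚ r
    0≤r = 0≤recip (B ^ (ℓ + k + 1))
    0≤1+y : 0ℚ ≤ℚ 1ℚ +ℚ y
    0≤1+y = ℚ.+-mono-≤ (ℕ→ℚ-mono-≤ {0} {1} z≤n) (0≤radInv s)
    r≡acu : r ≡ a *ℚ c *ℚ u
    r≡acu = trans (recip-B^[i+1] (ℓ + k)) (cong (_*ℚ u) (recip-B^-+ ℓ k))
    expand : ∀ b X w t → w * (X * ((2 + b) * 1)) + (2 + b + 1) * X * (1 + (2 + b) * (1 + w) * t)
                       ≡ (1 + (1 + (2 + b + 1) * t) * (1 + w) * (2 + b)) * X
    expand = solve-∀
    regroup : ∀ {v} → 1 + w ≡ v →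
      w * (B ^ ℓ * (B * 1)) + (B + 1) * B ^ ℓ * (1 + B * v * t) ≡ (1 + s * v * B) * B ^ ℓ
    regroup refl = expand b (B ^ ℓ) w t
    m≡ : m ≡ (1 + s * B ^ k * B) * B ^ ℓ
    m≡ = trans (cong (λ z → w * z + (B + 1) * B ^ ℓ * (1 + B ^ suc k * t)) (^-distribˡ-+-* B ℓ 1))
               (regroup (m+[n∸m]≡n (m^n>0 B k)))
    open +-*-Solver
    difference : ∀ a c u y →
      (1ℚ - c) *ℚ (a *ℚ u) - (1ℚ +ℚ y *ℚ c) *ℚ u *ℚ a ≡ - ((1ℚ +ℚ y) *ℚ (a *ℚ c *ℚ u))
    difference = solve 4 (λ a c u y → (con 1ℚ :- c) :* (a :* u) :- (con 1ℚ :+ y :* c) :* u :* a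
                                      := :- ((con 1ℚ :+ y) :* (a :* c :* u))) refl

radInv-close : ∀ {B} → 2 ≤ B → ∀ N n {d} → B ^ N ∣ d → ∣ radInv B n - radInv B (n + d) ∣ ≤ℚ recip (B ^ N)
radInv-close {suc (suc b)} _ N n (divides t refl) = RadicalInverse.radInv-close b n N t
radInv-close {suc zero} (s≤s ())

radInv-carry : ∀ {B} → 2 ≤ B → ∀ ℓ k {P} → P ≡1[mod B ^ suc k ] →
  ∣ radInv B ((B ^ k ∸ 1) * B ^ (ℓ + 1)) - radInv B ((B ^ k ∸ 1) * B ^ (ℓ + 1) + (B + 1) * B ^ ℓ * P) ∣
    ≤ℚ ℕ→ℚ 2 *ℚ recip (B ^ (ℓ + k + 1))
radInv-carry {suc (suc b)} _ = RadicalInverse.radInv-carry b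
radInv-carry {suc zero} (s≤s ())

2≤⇒NonZero : ∀ {n} → 2 ≤ n → NonZero n
2≤⇒NonZero (s≤s _) = _

proposition2p3 : (e : ℕ) → 1 ≤ e → (b₁ : ℕ) → (b : Fin e → ℕ) → 2 ≤ b₁ → (∀ j → 2 ≤ b j) →
    (∀ j → Coprime b₁ (b j)) → (∀ i j → i ≢ j → Coprime (b i) (b j)) →
    (ℓ k : ℕ) → (c : Fin e → ℕ) → 1 ≤ ℓ → 1 ≤ k → (∀ j → 1 ≤ c j) →
    let r = totient b₁
        n = (b₁ ^ k ∸ 1) * b₁ ^ (ℓ + 1)
        m = n + (b₁ + 1) * b₁ ^ ℓ * prodFin e (λ j → b j ^ (r * c j * b₁ ^ k))
    in (∀ j → ∣ radInv (b j) n - radInv (b j) m ∣ ≤ℚ recip (b j ^ (r * c j * b₁ ^ k)))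
       × (∣ radInv b₁ n - radInv b₁ m ∣ ≤ℚ ℕ→ℚ 2 *ℚ recip (b₁ ^ (ℓ + k + 1)))
proposition2p3 e _ b₁ b 2≤b₁ 2≤b b₁⊥b _ ℓ k c _ _ _ =
  (λ j → radInv-close (2≤b j) (N j) n (f∣m∸n j)) , radInv-carry 2≤b₁ ℓ k prodFin≡1
  where
  n = (b₁ ^ k ∸ 1) * b₁ ^ (ℓ + 1)
  N f : Fin e → ℕ
  N j = totient b₁ * c j * b₁ ^ k
  f j = b j ^ N j
  f∣m∸n : ∀ j → f j ∣ (b₁ + 1) * b₁ ^ ℓ * prodFin e f
  f∣m∸n j = ∣-trans (∈⇒∣product (∈-map⁺ f (∈-allFin j))) (n∣m*n ((b₁ + 1) * b₁ ^ ℓ))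
  f≡1 : ∀ j → f j ≡1[mod b₁ ^ suc k ]
  f≡1 j = euler-lift {{2≤⇒NonZero 2≤b₁}} {{2≤⇒NonZero (2≤b j)}} (Coprime.sym (b₁⊥b j)) (c j) k
  prodFin≡1 : prodFin e f ≡1[mod b₁ ^ suc k ]
  prodFin≡1 = ≡1[mod]-product (map⁺ (universal f≡1 (allFin e)))
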